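{- For all integers $d\ge 1$ and $n\ge 1$, the directed metric dimension of $\vec{\mathcal B}(d,n)$ is $d^{n-1}(d-1)$.
   Context: $\mathcal A_d=\{0,1,\dots,d-1\}$. The directed de Bruijn graph $\vec{\mathcal B}(d,n)$ has vertex set $\mathcal A_d^n$ (strings of length $n$ over $\mathcal A_d$) and an arc from $x_1\cdots x_n$ to $y_1\cdots y_n$ iff $x_2\cdots x_n=y_1\cdots y_{n-1}$. $\vec d(u,v)$ is the length of a shortest directed walk from $u$ to $v$ ($\vec d(v,v)=0$). A directed resolving set is a set $S$ of vertices such that for all distinct vertices $u,v$ there is $s\in S$ with $\vec d(s,u)\ne\vec d(s,v)$. The directed metric dimension is the minimum size of a directed resolving set. -}

module Defs where

open import Data.Nat using (ℕ; zero; suc; _<_)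
open import Data.Fin using (Fin)
open import Data.Vec using (Vec; tail; init)
open import Data.Unit using (⊤)
open import Data.Product using (Σ; ∃; _×_)
open import Data.List using (List; length)
open import Data.List.Membership.Propositional using (_∈_)
open import Data.List.Relation.Unary.Unique.Propositional using (Unique)
open import Relation.Binary.PropositionalEquality using (_≡_; _≢_)
open import Relation.Nullary using (¬_)

Vertex : ℕ → ℕ → Set
Vertex d n = Vec (Fin d) n

Arc : ∀ {d n} → Vertex d n → Vertex d n → Set
Arc {n = zero}  x y = ⊤
Arc {n = suc m} x y = tail x ≡ init y

data Walk {d n : ℕ} : Vertex d n → Vertex d n → ℕ → Set where
  here : ∀ {u} → Walk u u 0
  step : ∀ {u w v k} → Arc u w → Walk w v k → Walk u v (suc k)

Dist : ∀ {d n} → Vertex d n → Vertex d n → ℕ → Set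
Dist u v k = Walk u v k × (∀ j → j < k → ¬ Walk u v j)

Resolving : ∀ {d n} → List (Vertex d n) → Set
Resolving {d} {n} S =
  ∀ (u v : Vertex d n) → u ≢ v →
    ∃ λ s → s ∈ S × ∃ λ a → ∃ λ b → Dist s u a × Dist s v b × a ≢ b

IsDirMetricDim : ℕ → ℕ → ℕ → Set
IsDirMetricDim d n m =
  (Σ (List (Vertex d n)) λ S → Unique S × Resolving S × length S ≡ m)
  × (∀ (S : List (Vertex d n)) → Unique S → Resolving S → m Data.Nat.≤ length S)

-- Directed distances are governed by overlaps: a walk of length j from x to y
-- exists iff x_{i+j} = y_i for all i with i + j < n (`walk⇒overlap`,
-- `overlap⇒walk`).  This makes walks decidable, so distances exist
-- (`dist-exists`), and shows that walks of positive length into a vertex only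
-- depend on its first n - 1 symbols.
--
-- Lower bound: two "twins" u ≠ v with init u = init v are at equal distance from
-- every other vertex, so a resolving set S contains one of them; for each of the
-- d^(n-1) prefixes at most one of the d extensions is missing from S, and an
-- injection into S gives |S| ≥ d^(n-1) (d - 1).
-- Upper bound: the vertices with nonzero last symbol resolve: if u, v differ at
-- position p where v_p ≠ 0, the vertex c^L v₀⋯v_p (L = n - 1 - p, c ≠ u₀) is
-- in the set, reaches v in L steps and reaches u in no fewer than L + 1.
module Submission where

open import Defs
open import Data.Nat using (ℕ; zero; suc; _+_; _*_; _^_; _<_; _≤_; _∸_; z≤n; s≤s)
open import Data.Nat.Properties
open import Data.Fin using (Fin; zero; suc; combine; remQuot; punchIn)
import Data.Fin.Properties as Fin
open import Data.Vec using (Vec; []; _∷_; _∷ʳ_; head; tail; init; last; initLast)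
open import Data.Vec.Properties using (init-∷ʳ; ∷ʳ-injective; ∷ʳ-injectiveʳ)
import Data.Vec.Properties as Vec
open import Data.List using (List; length; tabulate; lookup)
open import Data.List.Properties using (length-tabulate)
open import Data.List.Relation.Unary.Any using (index)
open import Data.List.Relation.Unary.Any.Properties using (lookup-index)
open import Data.List.Membership.Propositional using (_∈_)
import Data.List.Membership.DecPropositional as Membership
open import Data.List.Membership.Propositional.Properties using (∈-tabulate⁺)
open import Data.List.Relation.Unary.Unique.Propositional using (Unique)
open import Data.List.Relation.Unary.Unique.Propositional.Properties using (tabulate⁺)
open import Data.Maybe using (Maybe; just; nothing; fromMaybe)
import Data.Maybe.Properties as Maybe
open import Data.Product using (∃; _×_; _,_; proj₁; proj₂; map₁)
open import Data.Sum using (_⊎_; inj₁; inj₂; [_,_]′)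
open import Data.Empty using (⊥-elim)
open import Relation.Binary.PropositionalEquality
open import Relation.Nullary using (¬_; Dec; yes; no)
open import Relation.Nullary.Decidable using (map′; _→-dec_; ¬?; decidable-stable)
open import Relation.Unary using (Decidable)
open import Function using (id; _∘_)
open import Function.Definitions using (Injective)

variable
  A : Set
  d k m n : ℕ

-- Index arithmetic such as `i + j` is what
-- the description of walks below needs, which is awkward with `Fin` indices.
at : Vec A n → ℕ → Maybe A
at []       _       = nothing
at (x ∷ xs) zero    = just x
at (x ∷ xs) (suc i) = at xs i

at-defined : (x : Vec A n) (i : ℕ) → i < n → ∃ λ a → at x i ≡ just a
at-defined (x ∷ xs) zero    _       = x , refl
at-defined (x ∷ xs) (suc i) (s≤s p) = at-defined xs i p

at-ext : (x y : Vec A n) → (∀ i → i < n → at x i ≡ at y i) → x ≡ y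
at-ext []       []       _ = refl
at-ext (a ∷ xs) (b ∷ ys) h with h 0 (s≤s z≤n)
... | refl = cong (a ∷_) (at-ext xs ys (λ i p → h (suc i) (s≤s p)))

at-∷ʳ-< : (xs : Vec A n) (a : A) (i : ℕ) → i < n → at (xs ∷ʳ a) i ≡ at xs i
at-∷ʳ-< (x ∷ xs) a zero    _       = refl
at-∷ʳ-< (x ∷ xs) a (suc i) (s≤s p) = at-∷ʳ-< xs a i p

at-∷ʳ-= : (xs : Vec A n) (a : A) → at (xs ∷ʳ a) n ≡ just a
at-∷ʳ-= []       a = refl
at-∷ʳ-= (x ∷ xs) a = at-∷ʳ-= xs a

init-∷ʳ-last : (y : Vec A (suc m)) → y ≡ init y ∷ʳ last y
init-∷ʳ-last y = proj₂ (proj₂ (initLast y))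

at-init : (y : Vec A (suc m)) (i : ℕ) → i < m → at (init y) i ≡ at y i
at-init y i p = begin
  at (init y) i            ≡⟨ at-∷ʳ-< (init y) (last y) i p ⟨
  at (init y ∷ʳ last y) i  ≡⟨ cong (λ z → at z i) (init-∷ʳ-last y) ⟨
  at y i                   ∎
  where open ≡-Reasoning

at-last : (y : Vec A (suc m)) → at y m ≡ just (last y)
at-last {m = m} y = trans (cong (λ z → at z m) (init-∷ʳ-last y)) (at-∷ʳ-= (init y) (last y))

-- A walk of length j from x to y exists exactly when x,
-- shifted left by j positions, agrees with y wherever both are defined:
-- each arc drops the first symbol and appends an arbitrary one.
Overlap : Vertex d n → Vertex d n → ℕ → Set
Overlap {n = n} x y j = ∀ i → i + j < n → at x (i + j) ≡ at y i

walk⇒overlap : {x y : Vertex d n} {j : ℕ} → Walk x y j → Overlap x y j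
walk⇒overlap {x = x} here i _ = cong (at x) (+-identityʳ i)
walk⇒overlap {n = suc m} {x = a ∷ xs} {y} (step {w = w} {k = k} xs≡init-w walk) i p = begin
  at (a ∷ xs) (i + suc k)  ≡⟨ cong (at (a ∷ xs)) (+-suc i k) ⟩
  at xs (i + k)            ≡⟨ cong (λ z → at z (i + k)) xs≡init-w ⟩
  at (init w) (i + k)      ≡⟨ at-init w (i + k) i+k<m ⟩
  at w (i + k)             ≡⟨ walk⇒overlap walk i (m<n⇒m<1+n i+k<m) ⟩
  at y i                   ∎
  where
  open ≡-Reasoning
  i+k<m : i + k < m
  i+k<m = ≤-pred (subst (_< suc m) (+-suc i k) p)

walk-zero : {x y : Vertex d n} → Walk x y 0 → x ≡ y
walk-zero here = refl

-- The next vertex on a walk from x towards y that still has k steps to go: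
-- drop the first symbol of x and append the symbol of y at position m ∸ k,
-- which is the one an overlap with shift k demands.
next-toward : (x y : Vertex d (suc m)) → ℕ → Vertex d (suc m)
next-toward {m = m} x y k = tail x ∷ʳ fromMaybe (head x) (at y (m ∸ k))

overlap-step : (x y : Vertex d (suc m)) (k : ℕ) → Overlap x y (suc k) → Overlap (next-toward x y k) y k
overlap-step {m = m} (b ∷ xs) y k o i p with m≤n⇒m<n∨m≡n (≤-pred p)
... | inj₁ i+k<m = begin
  at (xs ∷ʳ a) (i + k)     ≡⟨ at-∷ʳ-< xs a (i + k) i+k<m ⟩
  at (b ∷ xs) (suc i + k)  ≡⟨ cong (at (b ∷ xs)) (+-suc i k) ⟨
  at (b ∷ xs) (i + suc k)  ≡⟨ o i (subst (_< suc m) (sym (+-suc i k)) (s≤s i+k<m)) ⟩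
  at y i                   ∎
  where
  open ≡-Reasoning
  a = fromMaybe b (at y (m ∸ k))
... | inj₂ i+k≡m with at-defined y i (s≤s (subst (i ≤_) i+k≡m (m≤m+n i k)))
...   | c , y-i = begin
  at (xs ∷ʳ a) (i + k)         ≡⟨ cong (at (xs ∷ʳ a)) i+k≡m ⟩
  at (xs ∷ʳ a) m               ≡⟨ at-∷ʳ-= xs a ⟩
  just a                       ≡⟨ cong (λ t → just (fromMaybe b (at y t))) m∸k≡i ⟩
  just (fromMaybe b (at y i))  ≡⟨ cong (just ∘ fromMaybe b) y-i ⟩
  just c                       ≡⟨ y-i ⟨
  at y i                       ∎
  where
  open ≡-Reasoning
  a = fromMaybe b (at y (m ∸ k))
  m∸k≡i : m ∸ k ≡ i
  m∸k≡i = trans (cong (_∸ k) (sym i+k≡m)) (m+n∸n≡m i k)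

overlap⇒walk : (x y : Vertex d (suc m)) (j : ℕ) → Overlap x y j → Walk x y j
overlap⇒walk x y zero o = subst (λ z → Walk x z 0) (at-ext x y agree) here
  where
  agree : ∀ i → i < _ → at x i ≡ at y i
  agree i p = trans (cong (at x) (sym (+-identityʳ i))) (o i (subst (_< _) (sym (+-identityʳ i)) p))
overlap⇒walk x@(b ∷ xs) y (suc k) o =
  step (sym (init-∷ʳ _ xs)) (overlap⇒walk (next-toward x y k) y k (overlap-step x y k o))

overlap? : (x y : Vertex d n) (j : ℕ) → Dec (Overlap x y j)
overlap? {n = n} x y j = map′ (λ h i p → h (m+n≤o⇒m≤o (suc i) p) p) (λ o {i} _ → o i)
  (allUpTo? (λ i → (i + j <? n) →-dec Maybe.≡-dec Fin._≟_ (at x (i + j)) (at y i)) n)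

walk? : (x y : Vertex d (suc m)) (j : ℕ) → Dec (Walk x y j)
walk? x y j = map′ (overlap⇒walk x y j) walk⇒overlap (overlap? x y j)

least : {P : ℕ → Set} → Decidable P → (N : ℕ) → (∃ λ n → n < N × P n) →
        ∃ λ a → P a × (∀ j → j < a → ¬ P j)
least {P = P} P? (suc N) (n , n<1+N , Pn) with anyUpTo? P? N
... | yes below = least P? N below
... | no none   = N , P-N , λ j j<N Pj → none (j , j<N , Pj)
  where
  P-N : P N
  P-N = [ (λ n<N → ⊥-elim (none (n , n<N , Pn))) , (λ n≡N → subst P n≡N Pn) ]′
          (m≤n⇒m<n∨m≡n (≤-pred n<1+N))

-- In B(d, n) with n ≥ 1 every vertex reaches every other one in n steps (the
-- overlap condition is vacuous), so directed distances always exist.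
dist-exists : (x y : Vertex d (suc m)) → ∃ (Dist x y)
dist-exists {m = m} x y = least (walk? x y) (suc (suc m)) (suc m , ≤-refl , overlap⇒walk x y (suc m) vacuous)
  where
  vacuous : Overlap x y (suc m)
  vacuous i p = ⊥-elim (≤⇒≯ (m≤n+m (suc m) i) p)

dist-zero : {x y : Vertex d n} → Dist x y 0 → x ≡ y
dist-zero = walk-zero ∘ proj₁

dist-≤ : {x y : Vertex d n} {b L : ℕ} → Dist x y b → Walk x y L → b ≤ L
dist-≤ (_ , shortest) walk = ≮⇒≥ (λ L<b → shortest _ L<b walk)

dist-> : {x y : Vertex d n} {a L : ℕ} → Dist x y a → (∀ j → j ≤ L → ¬ Walk x y j) → L < a
dist-> (walk , _) none = ≰⇒> (λ a≤L → none _ a≤L walk)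

-- The last arc of a
-- walk only sees the first n − 1 symbols of its target, so walks of positive
-- length into one twin can be redirected into the other.
twin-walk : {s u v : Vertex d (suc m)} {j : ℕ} → init u ≡ init v → Walk s u (suc j) → Walk s v (suc j)
twin-walk {m = m} {s} {u} {v} {j} same walk = overlap⇒walk s v (suc j) λ i p →
  let i<m = m+n≤o⇒m≤o (suc i) (≤-pred (subst (_< suc m) (+-suc i j) p)) in begin
  at s (i + suc j)  ≡⟨ walk⇒overlap walk i p ⟩
  at u i            ≡⟨ at-init u i i<m ⟨
  at (init u) i     ≡⟨ cong (λ z → at z i) same ⟩
  at (init v) i     ≡⟨ at-init v i i<m ⟩
  at v i            ∎
  where open ≡-Reasoning

twins-equidistant : {s u v : Vertex d (suc m)} {a b : ℕ} → init u ≡ init v → s ≢ u → s ≢ v →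
                    Dist s u a → Dist s v b → a ≡ b
twins-equidistant {a = zero}              _    s≢u _   Du _  = ⊥-elim (s≢u (dist-zero Du))
twins-equidistant {a = suc _} {b = zero}  _    _   s≢v _  Dv = ⊥-elim (s≢v (dist-zero Dv))
twins-equidistant {a = suc _} {b = suc _} same _   _   Du Dv =
  ≤-antisym (dist-≤ Du (twin-walk (sym same) (proj₁ Dv))) (dist-≤ Dv (twin-walk same (proj₁ Du)))

Separates : Vertex d n → Vertex d n → Vertex d n → Set
Separates s u v = ∃ λ a → ∃ λ b → Dist s u a × Dist s v b × a ≢ b

separates-sym : {s u v : Vertex d n} → Separates s u v → Separates s v u
separates-sym (a , b , Du , Dv , a≢b) = b , a , Dv , Du , a≢b ∘ sym

-- A resolving set contains one of any two distinct twins, since only the twins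
-- themselves can separate them.
twin-in-resolving : {S : List (Vertex d (suc m))} → Resolving S → (u v : Vertex d (suc m)) →
                    u ≢ v → init u ≡ init v → u ∈ S ⊎ v ∈ S
twin-in-resolving R u v u≢v same with R u v u≢v
... | s , s∈S , _ , _ , Du , Dv , a≢b with Vec.≡-dec Fin._≟_ s u | Vec.≡-dec Fin._≟_ s v
...   | yes refl | _        = inj₁ s∈S
...   | no _     | yes refl = inj₂ s∈S
...   | no s≢u   | no s≢v   = ⊥-elim (a≢b (twins-equidistant same s≢u s≢v Du Dv))

encode : Vec (Fin d) m → Fin (d ^ m)
encode []      = zero
encode (a ∷ w) = combine a (encode w)

decode : (m : ℕ) → Fin (d ^ m) → Vec (Fin d) m
decode         zero    _ = []
decode {d = d} (suc m) i = proj₁ (remQuot {d} (d ^ m) i) ∷ decode m (proj₂ (remQuot {d} (d ^ m) i))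

decode-encode : (w : Vec (Fin d) m) → decode m (encode w) ≡ w
decode-encode         []      = refl
decode-encode {d = d} {m = suc m} (a ∷ w) = begin
  decode (suc m) (combine a (encode w))  ≡⟨ cong (λ (q , r) → q ∷ decode m r) (Fin.remQuot-combine {d} a (encode w)) ⟩
  a ∷ decode m (encode w)                ≡⟨ cong (a ∷_) (decode-encode w) ⟩
  a ∷ w                                  ∎
  where open ≡-Reasoning

encode-decode : (m : ℕ) (i : Fin (d ^ m)) → encode (decode m i) ≡ i
encode-decode         zero    zero = refl
encode-decode {d = d} (suc m) i    = begin
  combine q (encode (decode m r))  ≡⟨ cong (combine q) (encode-decode m r) ⟩
  combine q r                      ≡⟨ Fin.combine-remQuot {d} (d ^ m) i ⟩
  i                                ∎
  where
  open ≡-Reasoning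
  q = proj₁ (remQuot {d} (d ^ m) i)
  r = proj₂ (remQuot {d} (d ^ m) i)

decode-injective : (m : ℕ) → Injective _≡_ _≡_ (decode {d} m)
decode-injective m {i} {j} e = begin
  i                   ≡⟨ encode-decode m i ⟨
  encode (decode m i) ≡⟨ cong encode e ⟩
  encode (decode m j) ≡⟨ encode-decode m j ⟩
  j                   ∎
  where open ≡-Reasoning

cell : Fin (d ^ m * k) → Vec (Fin d) m × Fin k
cell {m = m} {k = k} i = map₁ (decode m) (remQuot k i)

cell-combine : (w : Vec (Fin d) m) (r : Fin k) → cell (combine (encode w) r) ≡ (w , r)
cell-combine {m = m} {k = k} w r = begin
  map₁ (decode m) (remQuot k (combine (encode w) r))  ≡⟨ cong (map₁ (decode m)) (Fin.remQuot-combine (encode w) r) ⟩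
  (decode m (encode w) , r)                           ≡⟨ cong (_, r) (decode-encode w) ⟩
  (w , r)                                             ∎
  where open ≡-Reasoning

cell-injective : Injective _≡_ _≡_ (cell {d} {m} {k})
cell-injective {d = d} {m = m} {k = k} {i} {j} e = begin
  i                               ≡⟨ Fin.combine-remQuot {d ^ m} k i ⟨
  combine (proj₁ ri) (proj₂ ri)   ≡⟨ cong₂ combine (decode-injective m (cong proj₁ e)) (cong proj₂ e) ⟩
  combine (proj₁ rj) (proj₂ rj)   ≡⟨ Fin.combine-remQuot {d ^ m} k j ⟩
  j                               ∎
  where
  open ≡-Reasoning
  ri = remQuot {d ^ m} k i
  rj = remQuot {d ^ m} k j

-- Given a forbidden last symbol `avoid w` for every prefix w, the pair (w, r)
-- names the vertex w followed by the r-th symbol other than `avoid w`.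
extend : (Vec (Fin (suc k)) m → Fin (suc k)) → Vec (Fin (suc k)) m × Fin k → Vertex (suc k) (suc m)
extend avoid (w , r) = w ∷ʳ punchIn (avoid w) r

extend-injective : (avoid : Vec (Fin (suc k)) m → Fin (suc k)) → Injective _≡_ _≡_ (extend avoid)
extend-injective avoid {w , r} {w′ , r′} e with ∷ʳ-injective w w′ e
... | refl , last≡ = cong (w ,_) (Fin.punchIn-injective (avoid w) r r′ last≡)

injection-into-list : {f : Fin k → A} {S : List A} → Injective _≡_ _≡_ f → (∀ i → f i ∈ S) → k ≤ length S
injection-into-list {f = f} {S} f-injective f∈S = Fin.injective⇒≤ position-injective
  where
  position : Fin _ → Fin (length S)
  position i = index (f∈S i)
  position-injective : Injective _≡_ _≡_ position
  position-injective {i} {j} e = f-injective (begin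
    f i                     ≡⟨ lookup-index (f∈S i) ⟩
    lookup S (position i)   ≡⟨ cong (lookup S) e ⟩
    lookup S (position j)   ≡⟨ lookup-index (f∈S j) ⟨
    f j                     ∎)
    where open ≡-Reasoning

-- prepend c L v is c^L v cut to length n: each arc out of it shifts in one more
-- symbol of v, so a walk of length L leads from it to v.
prepend : A → ℕ → Vec A (suc m) → Vec A (suc m)
prepend c zero    v = v
prepend c (suc L) v = c ∷ init (prepend c L v)

prepend-walk : (c : Fin d) (L : ℕ) (v : Vertex d (suc m)) → Walk (prepend c L v) v L
prepend-walk c zero    v = here
prepend-walk c (suc L) v = step refl (prepend-walk c L v)

at-prepend-< : (c : A) (v : Vec A (suc m)) {L t : ℕ} → t < L → t < suc m → at (prepend c L v) t ≡ just c
at-prepend-< c v {suc L} {zero}  _         _       = refl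
at-prepend-< c v {suc L} {suc t} (s≤s t<L) (s≤s t<m) =
  trans (at-init (prepend c L v) t t<m) (at-prepend-< c v t<L (m<n⇒m<1+n t<m))

at-prepend-shift : (c : A) (v : Vec A (suc m)) (i L : ℕ) → i + L < suc m → at (prepend c L v) (i + L) ≡ at v i
at-prepend-shift c v i zero    _ = cong (at v) (+-identityʳ i)
at-prepend-shift {m = m} c v i (suc L) p = begin
  at (c ∷ init s) (i + suc L)  ≡⟨ cong (at (c ∷ init s)) (+-suc i L) ⟩
  at (init s) (i + L)          ≡⟨ at-init s (i + L) i+L<m ⟩
  at s (i + L)                 ≡⟨ at-prepend-shift c v i L (m<n⇒m<1+n i+L<m) ⟩
  at v i                       ∎
  where
  open ≡-Reasoning
  s = prepend c L v
  i+L<m : i + L < m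
  i+L<m = ≤-pred (subst (_< suc m) (+-suc i L) p)

-- Upper bound.  Over the alphabet Fin (suc k), the vertices whose last symbol
-- is nonzero: one for each prefix w and each label r, namely w ∷ʳ suc r.
nonzero-last : (k m : ℕ) → List (Vertex (suc k) (suc m))
nonzero-last k m = tabulate (extend (λ _ → zero) ∘ cell {suc k} {m} {k})

nonzero-last-length : (k m : ℕ) → length (nonzero-last k m) ≡ suc k ^ m * k
nonzero-last-length k m = length-tabulate (extend (λ _ → zero) ∘ cell {suc k} {m} {k})

nonzero-last-unique : (k m : ℕ) → Unique (nonzero-last k m)
nonzero-last-unique k m = tabulate⁺ (cell-injective ∘ extend-injective (λ _ → zero))

∈-nonzero-last : (x : Vertex (suc k) (suc m)) (r : Fin k) → last x ≡ suc r → x ∈ nonzero-last k m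
∈-nonzero-last {k} {m} x r last≡ = subst (_∈ nonzero-last k m) named (∈-tabulate⁺ (combine (encode (init x)) r))
  where
  open ≡-Reasoning
  named : extend (λ _ → zero) (cell (combine (encode (init x)) r)) ≡ x
  named = begin
    extend (λ _ → zero) (cell (combine (encode (init x)) r))  ≡⟨ cong (extend (λ _ → zero)) (cell-combine (init x) r) ⟩
    init x ∷ʳ suc r                                           ≡⟨ cong (init x ∷ʳ_) last≡ ⟨
    init x ∷ʳ last x                                          ≡⟨ init-∷ʳ-last x ⟨
    x                                                         ∎

differing-position : (u v : Vec (Fin d) n) → u ≢ v → ∃ λ p → p < n × at u p ≢ at v p
differing-position []      []      u≢v = ⊥-elim (u≢v refl)
differing-position (a ∷ u) (b ∷ v) u≢v with a Fin.≟ b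
... | no a≢b = 0 , s≤s z≤n , a≢b ∘ Maybe.just-injective
... | yes refl with differing-position u v (u≢v ∘ cong (a ∷_))
...   | p , p<n , differ = suc p , s≤s p<n , differ

-- The key construction: if u and v differ at position p and v carries the
-- nonzero symbol suc r there, then s = c^L v₀⋯v_p with L = n − 1 − p and c ≠ u₀
-- lies in the list and separates them: s reaches v in L steps, but no walk of
-- length j ≤ L reaches u (for j < L the symbol c would have to be u₀, for
-- j = L the symbol v_p would have to be u_p).
separate : (u v : Vertex (suc k) (suc m)) (p : ℕ) (r : Fin k) → p < suc m → at u p ≢ at v p →
           at v p ≡ just (suc r) → ∃ λ s → s ∈ nonzero-last k m × Separates s u v
separate {k} {m} u@(u₀ ∷ _) v p r p<n differ v-p = s , s∈list , a , b , Du , Dv , >⇒≢ b<a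
  where
  open ≡-Reasoning
  L = m ∸ p
  p+L≡m : p + L ≡ m
  p+L≡m = m+[n∸m]≡n (≤-pred p<n)
  c = punchIn u₀ r
  s = prepend c L v
  no-short-walk : ∀ j → j ≤ L → ¬ Walk s u j
  no-short-walk j j≤L walk with m≤n⇒m<n∨m≡n j≤L
  ... | inj₁ j<L = Fin.punchInᵢ≢i u₀ r (Maybe.just-injective (begin
    just c   ≡⟨ at-prepend-< c v j<L j<n ⟨
    at s j   ≡⟨ walk⇒overlap walk 0 j<n ⟩
    just u₀  ∎))
    where
    j<n : j < suc m
    j<n = s≤s (≤-trans (<⇒≤ j<L) (m∸n≤m m p))
  ... | inj₂ refl = differ (begin
    at u p        ≡⟨ walk⇒overlap walk p p+L<n ⟨
    at s (p + L)  ≡⟨ at-prepend-shift c v p L p+L<n ⟩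
    at v p        ∎)
    where
    p+L<n : p + L < suc m
    p+L<n = s≤s (≤-reflexive p+L≡m)
  a = proj₁ (dist-exists s u)
  Du = proj₂ (dist-exists s u)
  b = proj₁ (dist-exists s v)
  Dv = proj₂ (dist-exists s v)
  b<a : b < a
  b<a = ≤-<-trans (dist-≤ Dv (prepend-walk c L v)) (dist-> Du no-short-walk)
  s∈list : s ∈ nonzero-last k m
  s∈list = ∈-nonzero-last s r (Maybe.just-injective (begin
    just (last s)  ≡⟨ at-last s ⟨
    at s m         ≡⟨ cong (at s) p+L≡m ⟨
    at s (p + L)   ≡⟨ at-prepend-shift c v p L (s≤s (≤-reflexive p+L≡m)) ⟩
    at v p         ≡⟨ v-p ⟩
    just (suc r)   ∎))

-- Any two distinct vertices differ at some position where one of them carries a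
-- nonzero symbol, so `separate` applies (possibly with their roles swapped).
nonzero-last-resolving : (k m : ℕ) → Resolving (nonzero-last k m)
nonzero-last-resolving k m u v u≢v with differing-position u v u≢v
... | p , p<n , differ with at-defined u p p<n | at-defined v p p<n
...   | _     , u-p | suc r , v-p = separate u v p r p<n differ v-p
...   | zero  , u-p | zero  , v-p = ⊥-elim (differ (trans u-p (sym v-p)))
...   | suc r , u-p | zero  , v-p with separate v u p r p<n (differ ∘ sym) u-p
...     | s , s∈list , separation = s , s∈list , separates-sym separation

infix 4 _∈?_
_∈?_ : (x : Vertex d n) (S : List (Vertex d n)) → Dec (x ∈ S)
_∈?_ = Membership._∈?_ (Vec.≡-dec Fin._≟_)

-- Lower bound.  By `twin-in-resolving`, among the suc k extensions w ∷ʳ a of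
-- a prefix w at most one is missing from a resolving set S.
missing-extension : {S : List (Vertex (suc k) (suc m))} → Resolving S → (w : Vec (Fin (suc k)) m) →
                    ∃ λ a₀ → ∀ a → a ≢ a₀ → w ∷ʳ a ∈ S
missing-extension {S = S} R w with Fin.any? (λ a → ¬? (w ∷ʳ a ∈? S))
... | yes (a₀ , a₀∉S) = a₀ , λ a a≢a₀ →
  [ id , ⊥-elim ∘ a₀∉S ]′ (twin-in-resolving R (w ∷ʳ a) (w ∷ʳ a₀) (a≢a₀ ∘ ∷ʳ-injectiveʳ w w)
                            (trans (init-∷ʳ a w) (sym (init-∷ʳ a₀ w))))
... | no none = zero , λ a _ → decidable-stable (w ∷ʳ a ∈? S) (λ a∉S → none (a , a∉S))

-- So S contains every vertex `extend avoid (w , r)`, where avoid w is the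
-- possibly missing extension, and these are suc k ^ m * k distinct vertices.
lower-bound : (S : List (Vertex (suc k) (suc m))) → Resolving S → suc k ^ m * k ≤ length S
lower-bound {k} {m} S R = injection-into-list {f = extend avoid ∘ cell {suc k} {m} {k}}
  (cell-injective ∘ extend-injective avoid) (λ i → proj₂ (missing-extension R _) _ (Fin.punchInᵢ≢i _ _))
  where
  avoid : Vec (Fin (suc k)) m → Fin (suc k)
  avoid w = proj₁ (missing-extension R w)

theorem4p6 : ∀ (d n : ℕ) → 1 ≤ d → 1 ≤ n → IsDirMetricDim d n (d ^ (n ∸ 1) * (d ∸ 1))
theorem4p6 zero    _       ()
theorem4p6 (suc k) zero    _  ()
theorem4p6 (suc k) (suc m) _  _  =
  (nonzero-last k m , nonzero-last-unique k m , nonzero-last-resolving k m , nonzero-last-length k m) ,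
  λ S _ R → lower-bound S R
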